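{- For any backward trie $\mathsf{T}_{\mathsf{b}}$ with $n\ge 3$ nodes, $\mathsf{CDAWG}(\mathsf{T}_{\mathsf{b}})$ has at most $2n-3$ nodes and at most $2n-4$ edges, independently of the alphabet size.
   Context: Let $\Sigma$ be an ordered alphabet. A forward trie is a rooted tree with edges labeled by single characters of $\Sigma$, out-going edges of each node having distinct labels; the backward trie $\mathsf{T}_{\mathsf{b}}$ is obtained by reversing every edge (its root and leaves being those of the forward trie). For $v$ a descendant of $u$, $\mathit{str}_{\mathsf{b}}(v,u)$ is the string read along the reversed path from $v$ up to $u$; $\mathit{Substr}(\mathsf{T}_{\mathsf{b}})$ is the set of these strings. $Y\in\mathit{Substr}(\mathsf{T}_{\mathsf{b}})$ is left-maximal if there are distinct $a,b$ with $aY,bY\in\mathit{Substr}(\mathsf{T}_{\mathsf{b}})$ or $Y=\mathit{str}_{\mathsf{b}}(v,u)$ with $v$ a leaf; right-maximal if there are distinct $a,b$ with $Ya,Yb\in\mathit{Substr}(\mathsf{T}_{\mathsf{b}})$ or $Y=\mathit{str}_{\mathsf{b}}(v,r)$ with $r$ the root; maximal if both. $\mathit{mxml}_{\mathsf{b}}(Y)$ is the shortest maximal string of the form $\gamma Y\delta$. $\mathsf{CDAWG}(\mathsf{T}_{\mathsf{b}})$ has one node per equivalence class of $\mathit{Substr}(\mathsf{T}_{\mathsf{b}})$ under $Y\equiv Y'$ iff $\mathit{mxml}_{\mathsf{b}}(Y)=\mathit{mxml}_{\mathsf{b}}(Y')$ (each class having a longest member, a maximal string $X$); for each node with longest member $X$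 and each $a\in\Sigma$ with $Xa\in\mathit{Substr}(\mathsf{T}_{\mathsf{b}})$ there is one edge, labeled $a\beta$, to the class of $Xa$, where $\mathit{mxml}_{\mathsf{b}}(Xa)=\gamma Xa\beta$. Equivalently, it is obtained from the DAWG of $\mathsf{T}_{\mathsf{b}}$ by contracting non-branching paths. Convention: the root of the trie is connected to an auxiliary node $\bot$ by an edge labeled by a unique character $\$$ occurring nowhere else. -}

module Defs where

open import Data.Nat using (ℕ; zero; suc; _+_; _≤_)
open import Data.List using (List; []; _∷_; _++_; [_]; map; length; reverse)
open import Data.List.Membership.Propositional using (_∈_)
open import Data.List.Relation.Unary.Unique.Propositional using (Unique)
open import Data.Sum using (_⊎_)
open import Data.Product using (_×_; _,_; proj₁; ∃; ∃-syntax; Σ-syntax)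
open import Relation.Binary.PropositionalEquality using (_≡_; _≢_)

data Trie (A : Set) : Set where
  node : List (A × Trie A) → Trie A

data WellFormed {A : Set} : Trie A → Set where
  node : {cs : List (A × Trie A)} →
         Unique (map proj₁ cs) →
         (∀ {a t} → (a , t) ∈ cs → WellFormed t) →
         WellFormed (node cs)

mutual
  size : {A : Set} → Trie A → ℕ
  size (node cs) = suc (sizes cs)

  sizes : {A : Set} → List (A × Trie A) → ℕ
  sizes [] = zero
  sizes ((_ , t) ∷ cs) = size t + sizes cs

data Down {A : Set} : Trie A → List A → Set where
  here : ∀ {t} → Down t []
  step : ∀ {cs a t w} → (a , t) ∈ cs → Down t w → Down (node cs) (a ∷ w)

data DownLeaf {A : Set} : Trie A → List A → Set where
  leaf : DownLeaf (node []) []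
  step : ∀ {cs a t w} → (a , t) ∈ cs → DownLeaf t w → DownLeaf (node cs) (a ∷ w)

data Path {A : Set} : Trie A → List A → Set where
  top   : ∀ {t w} → Down t w → Path t w
  below : ∀ {cs a t w} → (a , t) ∈ cs → Path t w → Path (node cs) w

data PathLeaf {A : Set} : Trie A → List A → Set where
  top   : ∀ {t w} → DownLeaf t w → PathLeaf t w
  below : ∀ {cs a t w} → (a , t) ∈ cs → PathLeaf t w → PathLeaf (node cs) w

-- Backward trie strings: str_b(v,u) is the reversal of the forward label from u to v.
Substr : {A : Set} → Trie A → List A → Set
Substr t Y = Path t (reverse Y)

FromLeaf : {A : Set} → Trie A → List A → Set
FromLeaf t Y = PathLeaf t (reverse Y)

ToRoot : {A : Set} → Trie A → List A → Set
ToRoot t Y = Down t (reverse Y)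

LeftMaximal : {A : Set} → Trie A → List A → Set
LeftMaximal t Y =
  (∃[ a ] ∃[ b ] (a ≢ b × Substr t (a ∷ Y) × Substr t (b ∷ Y))) ⊎ FromLeaf t Y

RightMaximal : {A : Set} → Trie A → List A → Set
RightMaximal t Y =
  (∃[ a ] ∃[ b ] (a ≢ b × Substr t (Y ++ [ a ]) × Substr t (Y ++ [ b ]))) ⊎ ToRoot t Y

Maximal : {A : Set} → Trie A → List A → Set
Maximal t Y = Substr t Y × LeftMaximal t Y × RightMaximal t Y

Factor : {A : Set} → List A → List A → Set
Factor {A} Y Z = Σ[ γ ∈ List A ] Σ[ δ ∈ List A ] Z ≡ γ ++ Y ++ δ

IsMxml : {A : Set} → Trie A → List A → List A → Set
IsMxml t Y Z =
  Maximal t Z × Factor Y Z ×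
  (∀ Z′ → Maximal t Z′ → Factor Y Z′ → length Z ≤ length Z′)

-- Nodes of CDAWG(T_b): equivalence classes of Substr(T_b) under
-- Y ≡ Y′ iff mxml_b(Y) = mxml_b(Y′); a class is identified by the common value Z.
CDAWGNode : {A : Set} → Trie A → List A → Set
CDAWGNode t Z = ∃[ Y ] (Substr t Y × IsMxml t Y Z)

LongestMember : {A : Set} → Trie A → List A → List A → Set
LongestMember t Z X =
  Substr t X × IsMxml t X Z ×
  (∀ Y → Substr t Y → IsMxml t Y Z → length Y ≤ length X)

-- Edges of CDAWG(T_b): one per node (with longest member X) and character a
-- with X a ∈ Substr(T_b); identified by the pair (X , a).
CDAWGEdge : {A : Set} → Trie A → List A × A → Set
CDAWGEdge t (X , a) = (∃[ Z ] LongestMember t Z X) × Substr t (X ++ [ a ])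

-- Reading strings backwards turns T_b into the forward trie T.  A string Z is
-- right-maximal in T_b iff W = reverse Z labels a root-to-node path of T or is
-- preceded on paths of T by two distinct characters, and a CDAWG edge (X , a)
-- makes a ∷ reverse X the label of a path of T.  Every path label is a suffix of
-- one of the n root-to-node labels, so the CDAWG nodes and edges inject into the
-- nodes and edges of the compacted trie of these labels read backwards.  A
-- compacted trie of k strings has at most 2k − 1 nodes and 2k − 2 edges: each
-- inserted string adds at most a leaf and a branching node.  Applied to the n − 1
-- non-empty labels this gives 2n − 3 and 2n − 4 as soon as the empty word branches;
-- if it does not, no word branches at all, so every node is a root-to-node label
-- and every edge is the only one leaving a label other than the longest, giving
-- n and n − 1.
module Submission where

open import Defs
open import Data.Nat using (ℕ; suc; pred; _+_; _*_; _∸_; _≤_; _≥_; z≤n; s≤s; s≤s⁻¹)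
open import Data.Nat.Properties
  using (_≤?_; ≤-trans; ≤-reflexive; ≤-antisym; <-irrefl; ≰⇒>; m≤m+n; +-mono-≤;
         +-suc; *-suc; *-distribˡ-+; module ≤-Reasoning)
open import Data.List using (List; []; _∷_; _++_; [_]; length; map; reverse)
open import Data.List.Properties
  using (length-++; length-++-≤ˡ; length-++-≤ʳ; length-++-sucʳ; length-map; length-removeAt;
         length-removeAt′; ++-assoc; ++-identityʳ; ∷-injectiveˡ; ∷-injectiveʳ; reverse-++;
         reverse-injective)
open import Data.List.Extrema.Nat using (argmax; argmax-all; f[xs]≤f[argmax])
open import Data.List.Membership.Propositional using (_∈_)
open import Data.List.Membership.Propositional.Properties using (∈-++⁺ˡ; ∈-++⁺ʳ; ∈-map⁺)
open import Data.List.Relation.Unary.All as All using (All; []; _∷_)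
open import Data.List.Relation.Unary.All.Properties using (map⁺)
open import Data.List.Relation.Unary.Any using (here; there; index; _─_)
open import Data.List.Relation.Unary.AllPairs using ([]; _∷_)
open import Data.List.Relation.Unary.Unique.Propositional using (Unique)
open import Data.List.Relation.Binary.Sublist.Propositional using (_⊆_; []; _∷_; _∷ʳ_)
open import Data.List.Relation.Binary.Sublist.Propositional.Properties using (All-resp-⊆)
open import Data.Product using (_×_; _,_; proj₁; proj₂; ∃; ∃-syntax)
open import Data.Sum as Sum using (_⊎_; inj₁; inj₂)
open import Effect.Monad using (RawMonad)
open import Function using (_∘_)
open import Level using (0ℓ)
open import Relation.Nullary using (¬_; yes; no)
open import Relation.Nullary.Decidable using (decidable-stable; ¬¬-excluded-middle)
open import Relation.Nullary.Negation using (contradiction; ¬¬-Monad; ¬¬-map)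
open import Relation.Binary.PropositionalEquality
  using (_≡_; _≢_; refl; sym; trans; cong; cong₂; subst; ≢-sym; module ≡-Reasoning)

open RawMonad (¬¬-Monad {a = 0ℓ}) using (pure; _>>=_)

module _ {X : Set} where

  AtMost : ℕ → (X → Set) → Set
  AtMost k P = ∀ xs → Unique xs → All P xs → length xs ≤ k

  private variable
    k j : ℕ
    P Q : X → Set
    x y : X
    xs ys : List X

  atMost-stable : ¬ ¬ AtMost k P → AtMost k P
  atMost-stable {k} ¬¬bound xs u ps =
    decidable-stable (length xs ≤? k) (¬¬-map (λ bound → bound xs u ps) ¬¬bound)

  atMost-weaken : k ≤ j → AtMost k P → AtMost j P
  atMost-weaken k≤j bound xs u ps = ≤-trans (bound xs u ps) k≤j

  atMost-⊆ : (∀ {x} → Q x → P x) → AtMost k P → AtMost k Q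
  atMost-⊆ Q⇒P bound xs u qs = bound xs u (All.map Q⇒P qs)

  atMost-⊆¬¬ : (∀ {x} → Q x → ¬ ¬ P x) → AtMost k P → AtMost k Q
  atMost-⊆¬¬ {k = k} Q⇒¬¬P bound xs u qs =
    decidable-stable (length xs ≤? k) (¬¬-map (bound xs u) (All.mapM _ ¬¬-Monad Q⇒¬¬P qs))

  atMost-cases : ∀ {B : Set} → (B → AtMost k P) → (¬ B → AtMost k P) → AtMost k P
  atMost-cases yes-bound no-bound = atMost-stable (¬¬-map (λ where
    (yes b) → yes-bound b
    (no ¬b) → no-bound ¬b) ¬¬-excluded-middle)

  atMost-∅ : (∀ {x} → ¬ P x) → AtMost 0 P
  atMost-∅ ¬P []      _ _       = z≤n
  atMost-∅ ¬P (_ ∷ _) _ (p ∷ _) = contradiction p ¬P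

  atMost-subsingleton : (∀ {x y} → P x → P y → ¬ ¬ x ≡ y) → AtMost 1 P
  atMost-subsingleton _  []          _               _             = z≤n
  atMost-subsingleton _  (_ ∷ [])    _               _             = s≤s z≤n
  atMost-subsingleton eq (_ ∷ _ ∷ _) ((x≢y ∷ _) ∷ _) (px ∷ py ∷ _) =
    contradiction x≢y (eq px py)

  atMost-singleton : ∀ y → AtMost 1 (_≡ y)
  atMost-singleton y = atMost-subsingleton λ { refl refl → pure refl }

  ∈-─⁺ : (x∈ys : x ∈ ys) → y ∈ ys → y ≢ x → y ∈ (ys ─ x∈ys)
  ∈-─⁺ (here refl)  (here refl)  y≢x = contradiction refl y≢x
  ∈-─⁺ (here _)     (there y∈ys) _   = y∈ys
  ∈-─⁺ (there _)    (here refl)  _   = here refl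
  ∈-─⁺ (there x∈ys) (there y∈ys) y≢x = there (∈-─⁺ x∈ys y∈ys y≢x)

  atMost-∈ : ∀ ys → AtMost (length ys) (_∈ ys)
  atMost-∈ ys []       _            _                  = z≤n
  atMost-∈ ys (x ∷ xs) (x∉xs ∷ xs!) (x∈ys ∷ xs⊆ys) = begin
    suc (length xs)          ≤⟨ s≤s (atMost-∈ (ys ─ x∈ys) xs xs! xs⊆ys─x) ⟩
    suc (length (ys ─ x∈ys)) ≡⟨ length-removeAt′ ys (index x∈ys) ⟨
    length ys                ∎
    where
    open ≤-Reasoning
    xs⊆ys─x : All (_∈ (ys ─ x∈ys)) xs
    xs⊆ys─x = All.zipWith (λ (y∈ys , x≢y) → ∈-─⁺ x∈ys y∈ys (≢-sym x≢y)) (xs⊆ys , x∉xs)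

  atMost-∈-≢ : x ∈ ys → AtMost (pred (length ys)) (λ y → y ∈ ys × y ≢ x)
  atMost-∈-≢ {ys = ys} x∈ys =
    atMost-weaken (≤-reflexive (length-removeAt ys (index x∈ys)))
      (atMost-⊆ (λ (y∈ys , y≢x) → ∈-─⁺ x∈ys y∈ys y≢x) (atMost-∈ (ys ─ x∈ys)))

  Unique-resp-⊇ : ys ⊆ xs → Unique xs → Unique ys
  Unique-resp-⊇ []         []           = []
  Unique-resp-⊇ (_ ∷ʳ τ)   (_ ∷ xs!)    = Unique-resp-⊇ τ xs!
  Unique-resp-⊇ (refl ∷ τ) (x∉xs ∷ xs!) = All-resp-⊆ τ x∉xs ∷ Unique-resp-⊇ τ xs!

  data Partition (P Q : X → Set) (xs : List X) : Set where
    partitioned : ∀ {ys zs} → ys ⊆ xs → zs ⊆ xs → All P ys → All Q zs →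
                  length xs ≡ length ys + length zs → Partition P Q xs

  partition : All (λ x → P x ⊎ Q x) xs → Partition P Q xs
  partition [] = partitioned [] [] [] [] refl
  partition (inj₁ p ∷ pqs) with partitioned ys⊆ zs⊆ ps qs eq ← partition pqs =
    partitioned (refl ∷ ys⊆) (_ ∷ʳ zs⊆) (p ∷ ps) qs (cong suc eq)
  partition (inj₂ q ∷ pqs) with partitioned {ys} {zs} ys⊆ zs⊆ ps qs eq ← partition pqs =
    partitioned (_ ∷ʳ ys⊆) (refl ∷ zs⊆) ps (q ∷ qs)
      (trans (cong suc eq) (sym (+-suc (length ys) (length zs))))

  atMost-⊎ : AtMost k P → AtMost j Q → AtMost (k + j) (λ x → P x ⊎ Q x)
  atMost-⊎ {k = k} {j = j} boundP boundQ xs xs! pqs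
    with partitioned {ys} {zs} ys⊆ zs⊆ ps qs eq ← partition pqs = begin
    length xs             ≡⟨ eq ⟩
    length ys + length zs ≤⟨ +-mono-≤ (boundP ys (Unique-resp-⊇ ys⊆ xs!) ps)
                                      (boundQ zs (Unique-resp-⊇ zs⊆ xs!) qs) ⟩
    k + j                 ∎
    where open ≤-Reasoning

atMost-map : ∀ {X Y : Set} {P : Y → Set} {Q : X → Set} {k} (f : X → Y) →
             (∀ {x} → Q x → P (f x)) →
             (∀ {x y} → Q x → Q y → f x ≡ f y → ¬ ¬ x ≡ y) →
             AtMost k P → AtMost k Q
atMost-map {Q = Q} {k} f Q⇒Pf injective bound xs xs! qs = begin
  length xs         ≡⟨ length-map f xs ⟨
  length (map f xs) ≤⟨ bound (map f xs) (unique-map xs! qs) (map⁺ (All.map Q⇒Pf qs)) ⟩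
  k                 ∎
  where
  open ≤-Reasoning
  unique-map : ∀ {xs} → Unique xs → All Q xs → Unique (map f xs)
  unique-map []            []        = []
  unique-map (x∉xs ∷ xs!) (qx ∷ qs) =
    map⁺ (All.zipWith (λ (x≢y , qy) → λ fx≡fy → injective qx qy fx≡fy x≢y) (x∉xs , qs))
    ∷ unique-map xs! qs

∃-uncons : ∀ {X : Set} {xs : List X} → length xs ≥ 2 →
           ∃[ x ] ∃[ ys ] xs ≡ x ∷ ys × length ys ≥ 1
∃-uncons {xs = _ ∷ ys} (s≤s |ys|≥1) = _ , ys , refl , |ys|≥1

suc≤2* : ∀ {m} → 1 ≤ m → suc m ≤ 2 * m
suc≤2* {suc m} _ = subst (suc (suc m) ≤_) (sym (*-suc 2 m)) (s≤s (s≤s (m≤m+n m _)))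

module _ {A : Set} where

  Suffix : List A → List A → Set
  Suffix w r = ∃[ p ] p ++ w ≡ r

  suffix-refl : ∀ {w} → Suffix w w
  suffix-refl = [] , refl

  suffix-∷ : ∀ {x w r} → Suffix w r → Suffix w (x ∷ r)
  suffix-∷ {x} (p , refl) = x ∷ p , refl

  suffix-tail : ∀ {a w r} → Suffix (a ∷ w) r → Suffix w r
  suffix-tail {a} {w} (p , refl) = p ++ [ a ] , ++-assoc p [ a ] w

  suffix-trans : ∀ {u v w} → Suffix u v → Suffix v w → Suffix u w
  suffix-trans {u} (p , refl) (q , refl) = q ++ p , ++-assoc q p u

  suffix-length : ∀ {w r} → Suffix w r → length w ≤ length r
  suffix-length {w} (p , refl) = length-++-≤ʳ w {p}

  suffix-¬∷ : ∀ {a r} → ¬ Suffix (a ∷ r) r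
  suffix-¬∷ ar⊒r = <-irrefl refl (suffix-length ar⊒r)

  suffix-antisym : ∀ {u v} → Suffix u v → length v ≤ length u → u ≡ v
  suffix-antisym ([] , u≡v) _ = u≡v
  suffix-antisym {u} (x ∷ p , refl) |v|≤|u| =
    contradiction (≤-trans (s≤s (length-++-≤ʳ u {p})) |v|≤|u|) (<-irrefl refl)

  suffix-compare : ∀ {u v r} → Suffix u r → Suffix v r → length u ≤ length v → Suffix u v
  suffix-compare u⊒r             ([] , refl)    _       = u⊒r
  suffix-compare ([] , refl)     (y ∷ q , refl) |u|≤|v| =
    contradiction (≤-trans (s≤s (suffix-length (q , refl))) |u|≤|v|) (<-irrefl refl)
  suffix-compare (x ∷ p , refl)  (y ∷ q , e)    |u|≤|v| =
    suffix-compare (p , refl) (q , ∷-injectiveʳ e) |u|≤|v|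

  suffix-unique : ∀ {u v r} → Suffix u r → Suffix v r → length u ≡ length v → u ≡ v
  suffix-unique u⊒r v⊒r |u|≡|v| =
    suffix-antisym (suffix-compare u⊒r v⊒r (≤-reflexive |u|≡|v|)) (≤-reflexive (sym |u|≡|v|))

  suffix-head-unique : ∀ {a b w r} → Suffix (a ∷ w) r → Suffix (b ∷ w) r → a ≡ b
  suffix-head-unique aw⊒r bw⊒r = ∷-injectiveˡ (suffix-unique aw⊒r bw⊒r refl)

  LongestSuffix : (List A → Set) → List A → List A → Set
  LongestSuffix P s c = Suffix c s × P c × (∀ w → Suffix w s → P w → length w ≤ length c)

  longestSuffix : ∀ {P} → P [] → ∀ s → ¬ ¬ ∃ (LongestSuffix P s)
  longestSuffix P[] []      = pure ([] , suffix-refl , P[] , λ _ w⊒s _ → suffix-length w⊒s)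
  longestSuffix P[] (x ∷ s) = ¬¬-excluded-middle >>= λ where
    (yes P[x∷s]) → pure (x ∷ s , suffix-refl , P[x∷s] , λ _ w⊒s _ → suffix-length w⊒s)
    (no ¬P[x∷s]) → longestSuffix P[] s >>= λ (c , c⊒s , Pc , c-max) →
      pure (c , suffix-∷ c⊒s , Pc , λ where
        _ ([] , refl)    Pw → contradiction Pw ¬P[x∷s]
        w (_ ∷ p , refl) Pw → c-max w (p , refl) Pw)

  Occurs : List (List A) → List A → Set
  Occurs S w = ∃[ r ] r ∈ S × Suffix w r

  LeftBranching : List (List A) → List A → Set
  LeftBranching S w = ∃[ a ] ∃[ b ] a ≢ b × Occurs S (a ∷ w) × Occurs S (b ∷ w)

  -- Reading every string of S backwards, these are the nodes and the out-going
  -- edges of the compacted trie of S.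
  CompactNode : List (List A) → List A → Set
  CompactNode S w = w ∈ S ⊎ LeftBranching S w

  CompactEdge : List (List A) → List A × A → Set
  CompactEdge S (w , a) = CompactNode S w × Occurs S (a ∷ w)

  occurs-suffix : ∀ {S u v} → Suffix u v → Occurs S v → Occurs S u
  occurs-suffix u⊒v (r , r∈S , v⊒r) = r , r∈S , suffix-trans u⊒v v⊒r

  occurs-tail : ∀ {S a w} → Occurs S (a ∷ w) → Occurs S w
  occurs-tail = occurs-suffix ([ _ ] , refl)

  occurs-∷ : ∀ {s Q w} → Occurs (s ∷ Q) w → Suffix w s ⊎ Occurs Q w
  occurs-∷ (_ , here refl , w⊒s) = inj₁ w⊒s
  occurs-∷ (r , there r∈Q , w⊒r) = inj₂ (r , r∈Q , w⊒r)

  compactNode-occurs : ∀ {S w} → CompactNode S w → Occurs S w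
  compactNode-occurs (inj₁ w∈S)                  = _ , w∈S , suffix-refl
  compactNode-occurs (inj₂ (_ , _ , _ , aw , _)) = occurs-tail aw

  compactNode-singleton : ∀ {s w} → CompactNode [ s ] w → w ≡ s
  compactNode-singleton (inj₁ (here w≡s)) = w≡s
  compactNode-singleton (inj₂ (_ , _ , a≢b , (_ , here refl , aw⊒s) , (_ , here refl , bw⊒s))) =
    contradiction (suffix-head-unique aw⊒s bw⊒s) a≢b

  compactEdge-singleton : ∀ {s e} → ¬ CompactEdge [ s ] e
  compactEdge-singleton (w-node , (_ , here refl , aw⊒s)) with refl ← compactNode-singleton w-node =
    suffix-¬∷ aw⊒s

  -- Adding s to Q creates at most the nodes s and c, where s branches off, and two edges at c.
  module Insertion (s : List A) (Q : List (List A)) {c : List A}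
                   (c-longest : LongestSuffix (Occurs Q) s c) where

    private
      c⊒s = proj₁ c-longest
      c-occurs = proj₁ (proj₂ c-longest)
      c-max = proj₂ (proj₂ c-longest)

    extends-or-longest : ∀ {a w} → Suffix (a ∷ w) s → Occurs Q w → Occurs Q (a ∷ w) ⊎ w ≡ c
    extends-or-longest {a} {w} aw⊒s w-occurs with length (a ∷ w) ≤? length c
    ... | yes |aw|≤|c| = inj₁ (occurs-suffix (suffix-compare aw⊒s c⊒s |aw|≤|c|) c-occurs)
    ... | no  |aw|≰|c| = inj₂ (suffix-unique w⊒s c⊒s
                                 (≤-antisym (c-max w w⊒s w-occurs) (s≤s⁻¹ (≰⇒> |aw|≰|c|))))
      where w⊒s = suffix-tail aw⊒s

    branching-with-s : ∀ {a b w} → a ≢ b → Suffix (a ∷ w) s → Occurs Q (b ∷ w) →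
                       w ≡ c ⊎ LeftBranching Q w
    branching-with-s a≢b aw⊒s bw with extends-or-longest aw⊒s (occurs-tail bw)
    ... | inj₁ aw   = inj₂ (_ , _ , a≢b , aw , bw)
    ... | inj₂ w≡c  = inj₁ w≡c

    compactNode-insert : ∀ {w} → CompactNode (s ∷ Q) w → (w ≡ s ⊎ w ≡ c) ⊎ CompactNode Q w
    compactNode-insert (inj₁ (here w≡s))  = inj₁ (inj₁ w≡s)
    compactNode-insert (inj₁ (there w∈Q)) = inj₂ (inj₁ w∈Q)
    compactNode-insert (inj₂ (a , b , a≢b , aw , bw)) with occurs-∷ aw | occurs-∷ bw
    ... | inj₁ aw⊒s | inj₁ bw⊒s = contradiction (suffix-head-unique aw⊒s bw⊒s) a≢b
    ... | inj₁ aw⊒s | inj₂ bwQ  = Sum.map inj₂ inj₂ (branching-with-s a≢b aw⊒s bwQ)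
    ... | inj₂ awQ  | inj₁ bw⊒s = Sum.map inj₂ inj₂ (branching-with-s (≢-sym a≢b) bw⊒s awQ)
    ... | inj₂ awQ  | inj₂ bwQ  = inj₂ (inj₂ (a , b , a≢b , awQ , bwQ))

    atMost-compactNode-insert : ∀ {k} → AtMost k (CompactNode Q) →
                                AtMost (2 + k) (CompactNode (s ∷ Q))
    atMost-compactNode-insert bound = atMost-⊆ compactNode-insert
      (atMost-⊎ (atMost-⊎ (atMost-singleton s) (atMost-singleton c)) bound)

    -- The edge from c towards the new leaf s, and the lower half of an edge of Q split at c.
    LeafEdge : List A × A → Set
    LeafEdge (w , a) = w ≡ c × Suffix (a ∷ c) s

    SplitEdge : List A × A → Set
    SplitEdge (w , a) = w ≡ c × Occurs Q (a ∷ c) × ¬ CompactNode Q c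

    edge-at-c : ∀ {w a} → w ≡ c → Occurs Q (a ∷ w) →
                ¬ ¬ ((LeafEdge (w , a) ⊎ SplitEdge (w , a)) ⊎ CompactEdge Q (w , a))
    edge-at-c refl aw = ¬¬-map (λ where
      (yes c-node) → inj₂ (c-node , aw)
      (no ¬c-node) → inj₁ (inj₂ (refl , aw , ¬c-node))) ¬¬-excluded-middle

    compactEdge-insert : ∀ {e} → CompactEdge (s ∷ Q) e →
                         ¬ ¬ ((LeafEdge e ⊎ SplitEdge e) ⊎ CompactEdge Q e)
    compactEdge-insert (w-node , aw) with occurs-∷ aw | compactNode-insert w-node
    ... | inj₁ aw⊒s | inj₁ (inj₁ refl) = contradiction aw⊒s suffix-¬∷
    ... | inj₁ aw⊒s | inj₁ (inj₂ refl) = pure (inj₁ (inj₁ (refl , aw⊒s)))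
    ... | inj₁ aw⊒s | inj₂ w-nodeQ with extends-or-longest aw⊒s (compactNode-occurs w-nodeQ)
    ...   | inj₁ awQ  = pure (inj₂ (w-nodeQ , awQ))
    ...   | inj₂ refl = pure (inj₁ (inj₁ (refl , aw⊒s)))
    compactEdge-insert _ | inj₂ awQ | inj₂ w-nodeQ     = pure (inj₂ (w-nodeQ , awQ))
    compactEdge-insert _ | inj₂ awQ | inj₁ (inj₂ w≡c)  = edge-at-c w≡c awQ
    compactEdge-insert _ | inj₂ awQ | inj₁ (inj₁ refl) =
      edge-at-c (sym (suffix-antisym c⊒s (c-max s suffix-refl (occurs-tail awQ)))) awQ

    leafEdge-unique : ∀ {e e′} → LeafEdge e → LeafEdge e′ → ¬ ¬ e ≡ e′
    leafEdge-unique (refl , ac⊒s) (refl , bc⊒s) = pure (cong (c ,_) (suffix-head-unique ac⊒s bc⊒s))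

    splitEdge-unique : ∀ {e e′} → SplitEdge e → SplitEdge e′ → ¬ ¬ e ≡ e′
    splitEdge-unique (refl , ac , ¬c-node) (refl , bc , _) e≢e′ =
      ¬c-node (inj₂ (_ , _ , e≢e′ ∘ cong (c ,_) , ac , bc))

    atMost-compactEdge-insert : ∀ {k} → AtMost k (CompactEdge Q) →
                                AtMost (2 + k) (CompactEdge (s ∷ Q))
    atMost-compactEdge-insert bound =
      atMost-⊆¬¬ compactEdge-insert
        (atMost-⊎ (atMost-⊎ (atMost-subsingleton leafEdge-unique) (atMost-subsingleton splitEdge-unique))
                  bound)

  occurs-[] : ∀ {s Q} → Occurs (s ∷ Q) []
  occurs-[] {s} = s , here refl , s , ++-identityʳ s

  atMost-compactNode : ∀ s Q → AtMost (suc (2 * length Q)) (CompactNode (s ∷ Q))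
  atMost-compactNode s []       = atMost-⊆ compactNode-singleton (atMost-singleton s)
  atMost-compactNode s (s′ ∷ Q) = atMost-stable do
    _ , c-longest ← longestSuffix occurs-[] s
    pure (atMost-weaken (≤-reflexive (cong suc (sym (*-suc 2 (length Q)))))
           (Insertion.atMost-compactNode-insert s (s′ ∷ Q) c-longest (atMost-compactNode s′ Q)))

  atMost-compactEdge : ∀ s Q → AtMost (2 * length Q) (CompactEdge (s ∷ Q))
  atMost-compactEdge s []       = atMost-∅ compactEdge-singleton
  atMost-compactEdge s (s′ ∷ Q) = atMost-stable do
    _ , c-longest ← longestSuffix occurs-[] s
    pure (atMost-weaken (≤-reflexive (sym (*-suc 2 (length Q))))
           (Insertion.atMost-compactEdge-insert s (s′ ∷ Q) c-longest (atMost-compactEdge s′ Q)))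

module _ {A : Set} where

  mutual
    rootPathLabels : Trie A → List (List A)
    rootPathLabels (node cs) = [] ∷ childPathLabels cs

    childPathLabels : List (A × Trie A) → List (List A)
    childPathLabels []             = []
    childPathLabels ((a , t) ∷ cs) = map (a ∷_) (rootPathLabels t) ++ childPathLabels cs

  mutual
    length-rootPathLabels : ∀ t → length (rootPathLabels t) ≡ size t
    length-rootPathLabels (node cs) = cong suc (length-childPathLabels cs)

    length-childPathLabels : ∀ cs → length (childPathLabels cs) ≡ sizes cs
    length-childPathLabels []             = refl
    length-childPathLabels ((a , t) ∷ cs) = begin
      length (map (a ∷_) labels ++ childPathLabels cs)
        ≡⟨ length-++ (map (a ∷_) labels) ⟩
      length (map (a ∷_) labels) + length (childPathLabels cs)
        ≡⟨ cong₂ _+_ (length-map (a ∷_) labels) (length-childPathLabels cs) ⟩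
      length labels + sizes cs
        ≡⟨ cong (_+ sizes cs) (length-rootPathLabels t) ⟩
      size t + sizes cs
        ∎
      where
      open ≡-Reasoning
      labels = rootPathLabels t

  ∈-childPathLabels : ∀ {cs a t r} → (a , t) ∈ cs → r ∈ rootPathLabels t →
                      a ∷ r ∈ childPathLabels cs
  ∈-childPathLabels {(b , _) ∷ _} (here refl) r∈ = ∈-++⁺ˡ (∈-map⁺ (b ∷_) r∈)
  ∈-childPathLabels {(b , u) ∷ _} (there at∈) r∈ =
    ∈-++⁺ʳ (map (b ∷_) (rootPathLabels u)) (∈-childPathLabels at∈ r∈)

  down⇒∈ : ∀ {t w} → Down t w → w ∈ rootPathLabels t
  down⇒∈ {node _} here          = here refl
  down⇒∈          (step at∈ w↓) = there (∈-childPathLabels at∈ (down⇒∈ w↓))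

  path⇒occurs : ∀ {t w} → Path t w → Occurs (rootPathLabels t) w
  path⇒occurs (top w↓) = _ , down⇒∈ w↓ , suffix-refl
  path⇒occurs (below {a = a} at∈ w-path) with r , r∈ , w⊒r ← path⇒occurs w-path =
    a ∷ r , there (∈-childPathLabels at∈ r∈) , suffix-∷ w⊒r

  path-head : ∀ {t : Trie A} {a w} → Path t (a ∷ w) → Path t [ a ]
  path-head (top (step at∈ _)) = top (step at∈ here)
  path-head (below at∈ aw)     = below at∈ (path-head aw)

  occurs-childPathLabels : ∀ {cs a w} → Occurs (rootPathLabels (node cs)) (a ∷ w) →
                           Occurs (childPathLabels cs) (a ∷ w)
  occurs-childPathLabels aw with occurs-∷ aw
  ... | inj₁ aw⊒[] = contradiction (suffix-length aw⊒[]) λ ()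
  ... | inj₂ aw    = aw

  -- RightMaximal t (reverse W) and the CDAWG edges leaving it, stated on forward labels W.
  RightMaximalʳ : Trie A → List A → Set
  RightMaximalʳ t W = (∃[ a ] ∃[ b ] a ≢ b × Path t (a ∷ W) × Path t (b ∷ W)) ⊎ Down t W

  OutEdgeʳ : Trie A → List A × A → Set
  OutEdgeʳ t (W , a) = RightMaximalʳ t W × Path t (a ∷ W)

  module RootedTrie (cs : List (A × Trie A)) {s Q} (labels≡ : childPathLabels cs ≡ s ∷ Q)
                    (|Q|≥1 : length Q ≥ 1) where

    private
      t = node cs
      S = childPathLabels cs
      labels = rootPathLabels t
      m = length Q

    2*size≡ : 2 * size t ≡ 4 + 2 * m
    2*size≡ = trans (cong (λ n → 2 * suc n) |S|≡) (*-distribˡ-+ 2 2 m)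
      where |S|≡ = trans (sym (length-childPathLabels cs)) (cong length labels≡)

    occurs-S : ∀ {a w} → Path t (a ∷ w) → Occurs S (a ∷ w)
    occurs-S = occurs-childPathLabels {cs} ∘ path⇒occurs

    root-branching : ∀ {a b W} → a ≢ b → Path t (a ∷ W) → Path t (b ∷ W) → LeftBranching S []
    root-branching a≢b aW bW =
      _ , _ , a≢b , occurs-S (path-head aW) , occurs-S (path-head bW)

    rightMaximalʳ⇒compactNode : LeftBranching S [] → ∀ {W} → RightMaximalʳ t W → CompactNode S W
    rightMaximalʳ⇒compactNode _ (inj₁ (a , b , a≢b , aW , bW)) =
      inj₂ (a , b , a≢b , occurs-S aW , occurs-S bW)
    rightMaximalʳ⇒compactNode []-branches (inj₂ W↓) with down⇒∈ W↓
    ... | here refl = inj₂ []-branches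
    ... | there W∈S = inj₁ W∈S

    rightMaximalʳ⇒∈ : ¬ LeftBranching S [] → ∀ {W} → RightMaximalʳ t W → W ∈ labels
    rightMaximalʳ⇒∈ ¬branching (inj₁ (_ , _ , a≢b , aW , bW)) =
      contradiction (root-branching a≢b aW bW) ¬branching
    rightMaximalʳ⇒∈ _          (inj₂ W↓)                    = down⇒∈ W↓

    atMost-rightMaximalʳ : AtMost (2 * size t ∸ 3) (RightMaximalʳ t)
    atMost-rightMaximalʳ =
      atMost-weaken (≤-reflexive (sym (cong (_∸ 3) 2*size≡))) (atMost-cases branching non-branching)
      where
      branching : LeftBranching S [] → AtMost (suc (2 * m)) (RightMaximalʳ t)
      branching []-branches = atMost-⊆ (rightMaximalʳ⇒compactNode []-branches)
        (subst (λ S → AtMost _ (CompactNode S)) (sym labels≡) (atMost-compactNode s Q))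
      non-branching : ¬ LeftBranching S [] → AtMost (suc (2 * m)) (RightMaximalʳ t)
      non-branching ¬branching =
        atMost-weaken (≤-trans (≤-reflexive (cong (suc ∘ length) labels≡)) (s≤s (suc≤2* |Q|≥1)))
          (atMost-⊆ (rightMaximalʳ⇒∈ ¬branching) (atMost-∈ labels))

    longestLabel : List A
    longestLabel = argmax length [] labels

    longestLabel-max : ∀ {r} → r ∈ labels → length r ≤ length longestLabel
    longestLabel-max = All.lookup (f[xs]≤f[argmax] {f = length} [] labels)

    outEdgeʳ⇒compactEdge : LeftBranching S [] → ∀ {e} → OutEdgeʳ t e → CompactEdge S e
    outEdgeʳ⇒compactEdge []-branches (W-rm , aW) =
      rightMaximalʳ⇒compactNode []-branches W-rm , occurs-S aW

    outEdgeʳ-source : ¬ LeftBranching S [] → ∀ {e} → OutEdgeʳ t e →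
                      proj₁ e ∈ labels × proj₁ e ≢ longestLabel
    outEdgeʳ-source ¬branching (W-rm , aW) with r , r∈ , aW⊒r ← path⇒occurs aW =
      rightMaximalʳ⇒∈ ¬branching W-rm ,
      λ { refl → <-irrefl refl (≤-trans (suffix-length aW⊒r) (longestLabel-max r∈)) }

    outEdgeʳ-source-injective : ¬ LeftBranching S [] → ∀ {e e′} → OutEdgeʳ t e → OutEdgeʳ t e′ →
                                proj₁ e ≡ proj₁ e′ → ¬ ¬ e ≡ e′
    outEdgeʳ-source-injective ¬branching {W , _} (_ , aW) (_ , bW) refl e≢e′ =
      ¬branching (root-branching (e≢e′ ∘ cong (W ,_)) aW bW)

    atMost-outEdgeʳ : AtMost (2 * size t ∸ 4) (OutEdgeʳ t)
    atMost-outEdgeʳ =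
      atMost-weaken (≤-reflexive (sym (cong (_∸ 4) 2*size≡))) (atMost-cases branching non-branching)
      where
      branching : LeftBranching S [] → AtMost (2 * m) (OutEdgeʳ t)
      branching []-branches = atMost-⊆ (outEdgeʳ⇒compactEdge []-branches)
        (subst (λ S → AtMost _ (CompactEdge S)) (sym labels≡) (atMost-compactEdge s Q))
      non-branching : ¬ LeftBranching S [] → AtMost (2 * m) (OutEdgeʳ t)
      non-branching ¬branching =
        atMost-weaken (≤-trans (≤-reflexive (cong length labels≡)) (suc≤2* |Q|≥1))
          (atMost-map proj₁ (outEdgeʳ-source ¬branching) (outEdgeʳ-source-injective ¬branching)
            (atMost-∈-≢ (argmax-all length (here refl) (All.tabulate (λ r∈ → r∈)))))

  factor-length : ∀ {Y Z : List A} → Factor Y Z → length Y ≤ length Z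
  factor-length {Y} (γ , δ , refl) = ≤-trans (length-++-≤ˡ Y) (length-++-≤ʳ (Y ++ δ) {γ})

  factor-antisym : ∀ {Y Z : List A} → Factor Y Z → length Z ≤ length Y → Y ≡ Z
  factor-antisym {Y} ([] , [] , refl) _ = sym (++-identityʳ Y)
  factor-antisym {Y} ([] , d ∷ δ , refl) |Z|≤|Y| =
    contradiction (≤-trans (s≤s (length-++-≤ˡ Y)) (subst (_≤ length Y) (length-++-sucʳ Y d δ) |Z|≤|Y|))
                  (<-irrefl refl)
  factor-antisym (_ ∷ γ , δ , refl) |Z|≤|Y| =
    contradiction (≤-trans (s≤s (factor-length (γ , δ , refl))) |Z|≤|Y|) (<-irrefl refl)

  -- Z is in its own class, so the longest member X of that class is at least as long as Z.
  longestMember-≡ : ∀ {t Z X} → LongestMember t Z X → X ≡ Z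
  longestMember-≡ {Z = Z} (_ , (Z-maximal , X-factor , _) , X-longest) =
    factor-antisym X-factor
      (X-longest Z (proj₁ Z-maximal) (Z-maximal , Z-factor , λ _ _ → factor-length))
    where Z-factor = [] , [] , sym (++-identityʳ Z)

  rightMaximal⇒rightMaximalʳ : ∀ {t Z} → RightMaximal t Z → RightMaximalʳ t (reverse Z)
  rightMaximal⇒rightMaximalʳ {t} {Z} (inj₁ (a , b , a≢b , Za , Zb)) =
    inj₁ (a , b , a≢b , subst (Path t) (reverse-++ Z [ a ]) Za , subst (Path t) (reverse-++ Z [ b ]) Zb)
  rightMaximal⇒rightMaximalʳ (inj₂ Z↓) = inj₂ Z↓

  cdawgNode⇒rightMaximalʳ : ∀ {t Z} → CDAWGNode t Z → RightMaximalʳ t (reverse Z)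
  cdawgNode⇒rightMaximalʳ {Z = Z} (_ , _ , (_ , _ , Z-rm) , _) = rightMaximal⇒rightMaximalʳ {Z = Z} Z-rm

  cdawgEdge⇒outEdgeʳ : ∀ {t X a} → CDAWGEdge t (X , a) → OutEdgeʳ t (reverse X , a)
  cdawgEdge⇒outEdgeʳ {t} {X} {a} ((_ , longest@(_ , ((_ , _ , Z-rm) , _) , _)) , Xa) =
    rightMaximal⇒rightMaximalʳ {Z = X} (subst (RightMaximal t) (sym (longestMember-≡ longest)) Z-rm) ,
    subst (Path t) (reverse-++ X [ a ]) Xa

theorem8 : {A : Set} (t : Trie A) → WellFormed t → 3 ≤ size t →
    ((Ns : List (List A)) → Unique Ns → All (CDAWGNode t) Ns →
      length Ns ≤ 2 * size t ∸ 3)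
    × ((Es : List (List A × A)) → Unique Es → All (CDAWGEdge t) Es →
      length Es ≤ 2 * size t ∸ 4)
theorem8 (node cs) _ (s≤s sizes≥2)
  with _ , _ , labels≡ , |Q|≥1 ← ∃-uncons (subst (_≥ 2) (sym (length-childPathLabels cs)) sizes≥2) =
    atMost-map reverse cdawgNode⇒rightMaximalʳ (λ _ _ → pure ∘ reverse-injective) atMost-rightMaximalʳ
  , atMost-map (λ (X , a) → reverse X , a) cdawgEdge⇒outEdgeʳ
      (λ _ _ e → pure (cong₂ _,_ (reverse-injective (cong proj₁ e)) (cong proj₂ e))) atMost-outEdgeʳ
  where open RootedTrie cs labels≡ |Q|≥1
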